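{- For all integers $n,k,r \geq 0$, \[ F(n+1,k,r) = a(r,n,k) = \sum_{j \geq 0} (-1)^j\binom{r+j}{r}a_j(r+j,n-j(k+1)). \]
   Context: For integers $k \geq 0$: $F(n,k)=0$ for $n\le 0$, $F(1,k)=1$, and $F(n,k)=\sum_{j=1}^k F(n-j,k)$ for $n\ge2$ (the $k$-step Fibonacci numbers). For $r \geq 0$, the $r$-th convolution $F(\cdot,k,r)$ is defined by: $F(n+1,k,r)$ is the coefficient of $x^n$ in $\left(\sum_{j \geq 0}F(j+1,k)x^j\right)^{r+1}$ for $n \geq 0$, and $F(n,k,r)=0$ for $n \le 0$. For integers $r,n,k\ge 0$, $a(r,n,k)$ is the number of tilings of a $1\times(n+r)$ grid by $r$ indistinguishable red $1\times 1$ squares and white tiles of lengths in $\{1,\dots,k\}$ of total length $n$ (order matters). $a(r,n)$ is the same with white tiles of arbitrary positive lengths; $a(r,n)=0$ for $n<0$. Set $a_0(r,n)=a(r,n)$ and $a_s(r,n)=\sum_{i=0}^n a_{s-1}(r,i)$ for $s\ge1$ ($0$ for $n<0$). -}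

module Defs where

open import Data.Nat using (ℕ; zero; suc; _+_; _*_; _∸_; _≡ᵇ_; _≤ᵇ_)
open import Data.Nat.Combinatorics using (_C_)
open import Data.Bool using (Bool; true; false; _∧_; if_then_else_)
open import Data.Nat.ListAction using (sum)
open import Data.List using (List; []; _∷_; map; take; upTo; concatMap; filterᵇ; length; all; foldr)
open import Data.Vec using (Vec; []; _∷_; toList; head)
open import Data.Integer using (ℤ; +_; -1ℤ) renaming (_+_ to _+ℤ_; _*_ to _*ℤ_; _^_ to _^ℤ_)

-- k-step Fibonacci numbers F(n,k) (for n ≤ 0 the value is 0; on ℕ
-- only n = 0 is relevant).
-- fibHist k n = [F(n,k), F(n-1,k), ..., F(0,k)]
fibHist : ℕ → (n : ℕ) → Vec ℕ (suc n)
fibHist k zero = 0 ∷ []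
fibHist k (suc zero) = 1 ∷ 0 ∷ []
fibHist k (suc (suc m)) =
  -- F(m+2) = Σ_{j=1}^{k} F(m+2-j)  (terms with m+2-j ≤ 0 are 0)
  sum (take k (toList (fibHist k (suc m)))) ∷ fibHist k (suc m)

F : ℕ → ℕ → ℕ
F n k = head (fibHist k n)

Series : Set
Series = ℕ → ℕ

conv : Series → Series → Series
conv f g n = sum (map (λ i → f i * g (n ∸ i)) (upTo (suc n)))

fibSeries : ℕ → Series
fibSeries k j = F (suc j) k

-- G(x)^(r+1)
fibSeriesPow : ℕ → ℕ → Series
fibSeriesPow k zero = fibSeries k
fibSeriesPow k (suc r) = conv (fibSeries k) (fibSeriesPow k r)

-- r-th convolution F(n,k,r): F(n+1,k,r) = [x^n] G^(r+1), F(n,k,r) = 0 for n ≤ 0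
Fconv : ℕ → ℕ → ℕ → ℕ
Fconv zero k r = 0
Fconv (suc n) k r = fibSeriesPow k r n

-- Tilings of a 1×(n+r) strip, as ordered lists of pieces.
data Piece : Set where
  red   : Piece
  white : ℕ → Piece

-- all pieces that could possibly occur when white length total is n
pieceAlphabet : ℕ → List Piece
pieceAlphabet n = red ∷ map (λ i → white (suc i)) (upTo n)

words : {A : Set} → List A → ℕ → List (List A)
words as zero = [] ∷ []
words as (suc m) = concatMap (λ w → map (λ a → a ∷ w) as) (words as m)

wordsUpTo : {A : Set} → List A → ℕ → List (List A)
wordsUpTo as N = concatMap (words as) (upTo (suc N))

numRed : List Piece → ℕ
numRed [] = 0
numRed (red ∷ ps) = suc (numRed ps)
numRed (white _ ∷ ps) = numRed ps

whiteLength : List Piece → ℕ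
whiteLength [] = 0
whiteLength (red ∷ ps) = whiteLength ps
whiteLength (white l ∷ ps) = l + whiteLength ps

whitesBounded : ℕ → List Piece → Bool
whitesBounded k [] = true
whitesBounded k (red ∷ ps) = whitesBounded k ps
whitesBounded k (white l ∷ ps) = (1 ≤ᵇ l) ∧ (l ≤ᵇ k) ∧ whitesBounded k ps

whitesPositive : List Piece → Bool
whitesPositive [] = true
whitesPositive (red ∷ ps) = whitesPositive ps
whitesPositive (white l ∷ ps) = (1 ≤ᵇ l) ∧ whitesPositive ps

-- a tiling has at most n+r pieces; enumerate all candidate piece lists and count
-- a(r,n,k): r red squares, white tiles with lengths in {1..k}, white total n
aTile : ℕ → ℕ → ℕ → ℕ
aTile r n k = length (filterᵇ
  (λ ps → (numRed ps ≡ᵇ r) ∧ (whiteLength ps ≡ᵇ n) ∧ whitesBounded k ps)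
  (wordsUpTo (pieceAlphabet n) (n + r)))

-- a(r,n): white tiles of arbitrary positive length (n ≥ 0; negative n handled by callers)
aFree : ℕ → ℕ → ℕ
aFree r n = length (filterᵇ
  (λ ps → (numRed ps ≡ᵇ r) ∧ (whiteLength ps ≡ᵇ n) ∧ whitesPositive ps)
  (wordsUpTo (pieceAlphabet n) (n + r)))

aIter : ℕ → ℕ → ℕ → ℕ
aIter zero r n = aFree r n
aIter (suc s) r n = sum (map (aIter s r) (upTo (suc n)))

-- a_s(r,m) with m = n - d possibly negative (value 0 when d > n)
aIterSub : ℕ → ℕ → ℕ → ℕ → ℕ
aIterSub s r n d = if d ≤ᵇ n then aIter s r (n ∸ d) else 0

sumℤ : List ℤ → ℤ
sumℤ = foldr _+ℤ_ (+ 0)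

-- Σ_{j≥0} (-1)^j C(r+j,r) a_j(r+j, n - j(k+1)); terms with j > n vanish
altSum : ℕ → ℕ → ℕ → ℤ
altSum r n k = sumℤ (map
  (λ j → (-1ℤ ^ℤ j) *ℤ (+ ((r + j) C r)) *ℤ (+ aIterSub j (r + j) n (j * (suc k))))
  (upTo (suc n)))

module Submission where

-- In integer power series, for p without constant term the powers
-- V r = (1 - p)^-(r+1) are the unique solution of V 0 = 1 + p V 0 and
-- V (r+1) = V r + p V (r+1) (powerFamily-unique).  After finite sums and the
-- Cauchy product, we show that three families solve this for p = x + … + x^k:
--   * the powers G_k^(r+1), as G_k = 1 + p G_k is the k-step recursion
--     (fibPow-family);
--   * the tiling counts a(r,·,k), classifying tilings by their first piece
--     (Counting.countsTilings, aTile-fibPow);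
--   * the alternating sums (altSeries-family): with free r the series of a(r,·)
--     and c = x^(k+1)/(1-x) we have x/(1-x) = p + c, so c^j free m splits
--     (peel) and the sum telescopes by Pascal's rule; multiplying by c shifts by
--     k+1 and takes partial sums, so c^j free m is n ↦ a_j(m, n - j(k+1)).
-- The theorem follows by uniqueness.

open import Defs
open import Data.Nat using (ℕ; zero; suc; _∸_; _≤_; _<_; z≤n; s≤s; _≤ᵇ_; _<ᵇ_; _≡ᵇ_; _≤?_)
  renaming (_+_ to _+ₙ_; _*_ to _*ₙ_)
import Data.Nat.Properties as ℕP
open import Data.Nat.Induction using (<-rec)
open import Data.Nat.Combinatorics using (_C_; nCk+nC[k+1]≡[n+1]C[k+1]; k>n⇒nCk≡0)
open import Data.Nat.ListAction using (sum)
open import Data.Integer using (ℤ; +_; _+_; _*_; _-_; -1ℤ; _^_)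
import Data.Integer.Properties as ℤP
open import Data.Integer.Tactic.RingSolver using (solve-∀)
open import Data.List using (List; []; _∷_; map; take; upTo; applyUpTo; _++_; concatMap; filterᵇ; length)
open import Data.Vec using (toList)
open import Data.Bool using (Bool; true; false; _∧_)
open import Data.Bool.Properties using (T-≡; ∧-assoc)
open import Data.Product using (_×_; _,_)
open import Function using (_∘_; Equivalence)
open import Relation.Nullary using (¬_; yes; no)
open import Relation.Binary.PropositionalEquality
open import Data.Empty using (⊥-elim)

𝟙 : Bool → ℤ
𝟙 true = + 1
𝟙 false = + 0

𝟙-∧ : ∀ a b → 𝟙 (a ∧ b) ≡ 𝟙 a * 𝟙 b
𝟙-∧ true b = sym (ℤP.*-identityˡ (𝟙 b))
𝟙-∧ false b = refl

≤ᵇ-true : ∀ {m n} → m ≤ n → (m ≤ᵇ n) ≡ true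
≤ᵇ-true le = Equivalence.to T-≡ (ℕP.≤⇒≤ᵇ le)

≤ᵇ-false : ∀ {m n} → ¬ (m ≤ n) → (m ≤ᵇ n) ≡ false
≤ᵇ-false {m} {n} m≰n with m ≤ᵇ n in eq
... | false = refl
... | true = ⊥-elim (m≰n (ℕP.≤ᵇ⇒≤ m n (Equivalence.from T-≡ eq)))

≤ᵇ-suc : ∀ l n → (suc l ≤ᵇ suc n) ≡ (l ≤ᵇ n)
≤ᵇ-suc zero n = refl
≤ᵇ-suc (suc l) n = refl

≤ᵇ-∸ : ∀ a b n → (suc a ≤ᵇ n ∸ b) ≡ (suc (a +ₙ b) ≤ᵇ n)
≤ᵇ-∸ a zero n rewrite ℕP.+-identityʳ a = refl
≤ᵇ-∸ a (suc b) zero = refl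
≤ᵇ-∸ a (suc b) (suc n) rewrite ℕP.+-suc a b = trans (≤ᵇ-∸ a b n) (sym (≤ᵇ-suc (suc (a +ₙ b)) n))

Σ : ℕ → (ℕ → ℤ) → ℤ
Σ zero f = + 0
Σ (suc n) f = Σ n f + f n

Σ-cong : ∀ n {f g : ℕ → ℤ} → (∀ i → i < n → f i ≡ g i) → Σ n f ≡ Σ n g
Σ-cong zero eq = refl
Σ-cong (suc n) eq = cong₂ _+_ (Σ-cong n (λ i i<n → eq i (ℕP.m<n⇒m<1+n i<n))) (eq n ℕP.≤-refl)

Σ-ext : ∀ n {f g : ℕ → ℤ} → (∀ i → f i ≡ g i) → Σ n f ≡ Σ n g
Σ-ext n eq = Σ-cong n (λ i _ → eq i)

Σ-zero : ∀ n {f : ℕ → ℤ} → (∀ i → i < n → f i ≡ + 0) → Σ n f ≡ + 0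
Σ-zero n eq = trans (Σ-cong n eq) (Σ-const0 n)
  where
  Σ-const0 : ∀ n → Σ n (λ _ → + 0) ≡ + 0
  Σ-const0 zero = refl
  Σ-const0 (suc n) = trans (ℤP.+-identityʳ _) (Σ-const0 n)

Σ-+ : ∀ n (f g : ℕ → ℤ) → Σ n (λ i → f i + g i) ≡ Σ n f + Σ n g
Σ-+ zero f g = refl
Σ-+ (suc n) f g = trans (cong (_+ (f n + g n)) (Σ-+ n f g)) (interchange (Σ n f) (Σ n g) (f n) (g n))
  where
  interchange : ∀ a b c d → a + b + (c + d) ≡ a + c + (b + d)
  interchange = solve-∀

Σ-*ˡ : ∀ n c (f : ℕ → ℤ) → Σ n (λ i → c * f i) ≡ c * Σ n f
Σ-*ˡ zero c f = sym (ℤP.*-zeroʳ c)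
Σ-*ˡ (suc n) c f = trans (cong (_+ c * f n) (Σ-*ˡ n c f)) (sym (ℤP.*-distribˡ-+ c (Σ n f) (f n)))

Σ-*ʳ : ∀ n c (f : ℕ → ℤ) → Σ n (λ i → f i * c) ≡ Σ n f * c
Σ-*ʳ n c f = trans (Σ-ext n (λ i → ℤP.*-comm (f i) c)) (trans (Σ-*ˡ n c f) (ℤP.*-comm c (Σ n f)))

Σ-split : ∀ a b (f : ℕ → ℤ) → Σ (a +ₙ b) f ≡ Σ a f + Σ b (λ i → f (a +ₙ i))
Σ-split a zero f rewrite ℕP.+-identityʳ a = sym (ℤP.+-identityʳ _)
Σ-split a (suc b) f rewrite ℕP.+-suc a b | Σ-split a b f = ℤP.+-assoc (Σ a f) _ _

Σ-first : ∀ n (f : ℕ → ℤ) → Σ (suc n) f ≡ f 0 + Σ n (f ∘ suc)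
Σ-first n f = trans (Σ-split 1 n f) (cong (_+ Σ n (f ∘ suc)) (ℤP.+-identityˡ (f 0)))

Σ-reverse : ∀ n (f : ℕ → ℤ) → Σ n (λ i → f (n ∸ suc i)) ≡ Σ n f
Σ-reverse zero f = refl
Σ-reverse (suc n) f = begin
    Σ (suc n) (λ i → f (suc n ∸ suc i))  ≡⟨ Σ-first n (λ i → f (suc n ∸ suc i)) ⟩
    f n + Σ n (λ i → f (n ∸ suc i))      ≡⟨ cong (_+_ (f n)) (Σ-reverse n f) ⟩
    f n + Σ n f                          ≡⟨ ℤP.+-comm (f n) (Σ n f) ⟩
    Σ n f + f n                          ∎
  where open ≡-Reasoning

Σ-swap : ∀ a b (f : ℕ → ℕ → ℤ) → Σ a (λ i → Σ b (f i)) ≡ Σ b (λ j → Σ a (λ i → f i j))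
Σ-swap zero b f = sym (Σ-zero b (λ _ _ → refl))
Σ-swap (suc a) b f = trans (cong (_+ Σ b (f a)) (Σ-swap a b f)) (sym (Σ-+ b (λ j → Σ a (λ i → f i j)) (f a)))

Σ-telescope : ∀ n (d : ℕ → ℤ) → Σ n (λ j → d j - d (suc j)) ≡ d 0 - d n
Σ-telescope zero d = sym (ℤP.+-inverseʳ (d 0))
Σ-telescope (suc n) d = trans (cong (_+ (d n - d (suc n))) (Σ-telescope n d)) (cancel (d 0) (d n) (d (suc n)))
  where
  cancel : ∀ a b c → a - b + (b - c) ≡ a - c
  cancel = solve-∀

Σ-triangle : ∀ N (f : ℕ → ℕ → ℤ) →
  Σ N (λ m → Σ (suc m) (λ i → f i m)) ≡ Σ N (λ i → Σ (N ∸ i) (λ t → f i (i +ₙ t)))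
Σ-triangle zero f = refl
Σ-triangle (suc N) f = begin
    Σ N rows + Σ (suc N) (λ i → f i N)
  ≡⟨ cong (_+ Σ (suc N) (λ i → f i N)) (Σ-triangle N f) ⟩
    Σ N cols + Σ (suc N) (λ i → f i N)
  ≡⟨ cong (_+ Σ (suc N) (λ i → f i N)) (sym lastColumnEmpty) ⟩
    Σ (suc N) cols + Σ (suc N) (λ i → f i N)
  ≡⟨ sym (Σ-+ (suc N) cols (λ i → f i N)) ⟩
    Σ (suc N) (λ i → cols i + f i N)
  ≡⟨ Σ-cong (suc N) extendColumn ⟩
    Σ (suc N) (λ i → Σ (suc N ∸ i) (λ t → f i (i +ₙ t)))
  ∎
  where
  open ≡-Reasoning
  rows : ℕ → ℤ
  rows m = Σ (suc m) (λ i → f i m)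
  cols : ℕ → ℤ
  cols i = Σ (N ∸ i) (λ t → f i (i +ₙ t))
  lastColumnEmpty : Σ (suc N) cols ≡ Σ N cols
  lastColumnEmpty rewrite ℕP.n∸n≡0 N = ℤP.+-identityʳ (Σ N cols)
  extendColumn : ∀ i → i < suc N → cols i + f i N ≡ Σ (suc N ∸ i) (λ t → f i (i +ₙ t))
  extendColumn i (s≤s i≤N) rewrite ℕP.+-∸-assoc 1 i≤N =
    cong (λ m → cols i + f i m) (sym (ℕP.m+[n∸m]≡n i≤N))

Σ-truncate : ∀ n m (f : ℕ → ℤ) → m ≤ n → Σ n (λ i → 𝟙 (suc i ≤ᵇ m) * f i) ≡ Σ m f
Σ-truncate n m f m≤n = begin
    Σ n g                                    ≡⟨ cong (λ x → Σ x g) (sym (ℕP.m+[n∸m]≡n m≤n)) ⟩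
    Σ (m +ₙ (n ∸ m)) g                       ≡⟨ Σ-split m (n ∸ m) g ⟩
    Σ m g + Σ (n ∸ m) (λ i → g (m +ₙ i))     ≡⟨ cong₂ _+_ (Σ-cong m kept) (Σ-zero (n ∸ m) dropped) ⟩
    Σ m f + + 0                              ≡⟨ ℤP.+-identityʳ _ ⟩
    Σ m f                                    ∎
  where
  open ≡-Reasoning
  g : ℕ → ℤ
  g i = 𝟙 (suc i ≤ᵇ m) * f i
  kept : ∀ i → i < m → g i ≡ f i
  kept i i<m rewrite ≤ᵇ-true i<m = ℤP.*-identityˡ (f i)
  dropped : ∀ i → i < n ∸ m → g (m +ₙ i) ≡ + 0
  dropped i _ rewrite ≤ᵇ-false (ℕP.m+n≮m m i) = refl

Σ-shift : ∀ n d (f : ℕ → ℤ) → Σ n (λ i → 𝟙 (d ≤ᵇ i) * f (i ∸ d)) ≡ Σ (n ∸ d) f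
Σ-shift zero d f rewrite ℕP.0∸n≡0 d = refl
Σ-shift (suc n) d f with d ≤? n
... | yes d≤n rewrite Σ-shift n d f | ≤ᵇ-true d≤n | ℕP.+-∸-assoc 1 d≤n =
  cong (_+_ (Σ (n ∸ d) f)) (ℤP.*-identityˡ _)
... | no d≰n rewrite Σ-shift n d f | ≤ᵇ-false d≰n | ℤP.+-identityʳ (Σ (n ∸ d) f) =
  cong (λ x → Σ x f) (trans (ℕP.m≤n⇒m∸n≡0 (ℕP.≰⇒≥ d≰n)) (sym (ℕP.m≤n⇒m∸n≡0 (ℕP.≰⇒> d≰n))))

ΣL : {X : Set} → List X → (X → ℤ) → ℤ
ΣL [] f = + 0
ΣL (x ∷ xs) f = f x + ΣL xs f

ΣL-ext : ∀ {X : Set} xs {f g : X → ℤ} → (∀ x → f x ≡ g x) → ΣL xs f ≡ ΣL xs g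
ΣL-ext [] eq = refl
ΣL-ext (x ∷ xs) eq = cong₂ _+_ (eq x) (ΣL-ext xs eq)

ΣL-+ : ∀ {X : Set} xs (f g : X → ℤ) → ΣL xs (λ x → f x + g x) ≡ ΣL xs f + ΣL xs g
ΣL-+ [] f g = refl
ΣL-+ (x ∷ xs) f g = trans (cong (_+_ (f x + g x)) (ΣL-+ xs f g)) (interchange (f x) (g x) (ΣL xs f) (ΣL xs g))
  where
  interchange : ∀ a b c d → a + b + (c + d) ≡ a + c + (b + d)
  interchange = solve-∀

ΣL-*ˡ : ∀ {X : Set} xs c (f : X → ℤ) → ΣL xs (λ x → c * f x) ≡ c * ΣL xs f
ΣL-*ˡ [] c f = sym (ℤP.*-zeroʳ c)
ΣL-*ˡ (x ∷ xs) c f = trans (cong (_+_ (c * f x)) (ΣL-*ˡ xs c f)) (sym (ℤP.*-distribˡ-+ c (f x) (ΣL xs f)))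

ΣL-zero : ∀ {X : Set} xs → ΣL {X} xs (λ _ → + 0) ≡ + 0
ΣL-zero [] = refl
ΣL-zero (x ∷ xs) = trans (ℤP.+-identityˡ _) (ΣL-zero xs)

ΣL-swap : ∀ {X Y : Set} xs ys (f : X → Y → ℤ) → ΣL xs (λ x → ΣL ys (f x)) ≡ ΣL ys (λ y → ΣL xs (λ x → f x y))
ΣL-swap [] ys f = sym (ΣL-zero ys)
ΣL-swap (x ∷ xs) ys f = trans (cong (_+_ (ΣL ys (f x))) (ΣL-swap xs ys f)) (sym (ΣL-+ ys (f x) (λ y → ΣL xs (λ x → f x y))))

ΣL-++ : ∀ {X : Set} xs ys (f : X → ℤ) → ΣL (xs ++ ys) f ≡ ΣL xs f + ΣL ys f
ΣL-++ [] ys f = sym (ℤP.+-identityˡ _)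
ΣL-++ (x ∷ xs) ys f = trans (cong (_+_ (f x)) (ΣL-++ xs ys f)) (sym (ℤP.+-assoc (f x) _ _))

ΣL-map : ∀ {X Y : Set} (g : X → Y) xs (f : Y → ℤ) → ΣL (map g xs) f ≡ ΣL xs (f ∘ g)
ΣL-map g [] f = refl
ΣL-map g (x ∷ xs) f = cong (_+_ (f (g x))) (ΣL-map g xs f)

ΣL-concatMap : ∀ {X Y : Set} (g : X → List Y) xs (f : Y → ℤ) → ΣL (concatMap g xs) f ≡ ΣL xs (λ x → ΣL (g x) f)
ΣL-concatMap g [] f = refl
ΣL-concatMap g (x ∷ xs) f = trans (ΣL-++ (g x) (concatMap g xs) f) (cong (_+_ (ΣL (g x) f)) (ΣL-concatMap g xs f))

ΣL-upTo : ∀ n (f : ℕ → ℤ) → ΣL (upTo n) f ≡ Σ n f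
ΣL-upTo n f = applyUpTo-Σ n (λ i → i)
  where
  applyUpTo-Σ : ∀ n (g : ℕ → ℕ) → ΣL (applyUpTo g n) f ≡ Σ n (f ∘ g)
  applyUpTo-Σ zero g = refl
  applyUpTo-Σ (suc n) g = trans (cong (_+_ (f (g 0))) (applyUpTo-Σ n (g ∘ suc))) (sym (Σ-first n (f ∘ g)))

sum-ΣL : ∀ {X : Set} xs (f : X → ℕ) → + sum (map f xs) ≡ ΣL xs (+_ ∘ f)
sum-ΣL [] f = refl
sum-ΣL (x ∷ xs) f = trans (ℤP.pos-+ (f x) (sum (map f xs))) (cong (_+_ (+ f x)) (sum-ΣL xs f))

sum-upTo : ∀ n (f : ℕ → ℕ) → + sum (map f (upTo n)) ≡ Σ n (+_ ∘ f)
sum-upTo n f = trans (sum-ΣL (upTo n) f) (ΣL-upTo n (+_ ∘ f))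

length-filter : ∀ {X : Set} (p : X → Bool) xs → + length (filterᵇ p xs) ≡ ΣL xs (𝟙 ∘ p)
length-filter p [] = refl
length-filter p (x ∷ xs) with p x
... | true = trans (ℤP.pos-+ 1 (length (filterᵇ p xs))) (cong (_+_ (+ 1)) (length-filter p xs))
... | false = trans (length-filter p xs) (sym (ℤP.+-identityˡ _))

ℤSeries : Set
ℤSeries = ℕ → ℤ

infixl 7 _⊛_
infixl 6 _⊕_

_⊛_ : ℤSeries → ℤSeries → ℤSeries
(f ⊛ g) n = Σ (suc n) (λ i → f i * g (n ∸ i))

_⊕_ : ℤSeries → ℤSeries → ℤSeries
(f ⊕ g) n = f n + g n

δ : ℤSeries
δ zero = + 1
δ (suc n) = + 0

⊛-cong : ∀ {f f′ g g′ : ℤSeries} → f ≗ f′ → g ≗ g′ → f ⊛ g ≗ f′ ⊛ g′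
⊛-cong f≗f′ g≗g′ n = Σ-ext (suc n) (λ i → cong₂ _*_ (f≗f′ i) (g≗g′ (n ∸ i)))

⊛-comm : ∀ (f g : ℤSeries) → f ⊛ g ≗ g ⊛ f
⊛-comm f g n = begin
    Σ (suc n) (λ i → f i * g (n ∸ i))                ≡⟨ sym (Σ-reverse (suc n) (λ i → f i * g (n ∸ i))) ⟩
    Σ (suc n) (λ i → f (n ∸ i) * g (n ∸ (n ∸ i)))    ≡⟨ Σ-cong (suc n) swapFactors ⟩
    Σ (suc n) (λ i → g i * f (n ∸ i))                ∎
  where
  open ≡-Reasoning
  swapFactors : ∀ i → i < suc n → f (n ∸ i) * g (n ∸ (n ∸ i)) ≡ g i * f (n ∸ i)
  swapFactors i (s≤s i≤n) rewrite ℕP.m∸[m∸n]≡n i≤n = ℤP.*-comm (f (n ∸ i)) (g i)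

⊛-distribʳ : ∀ (f g h : ℤSeries) → (f ⊕ g) ⊛ h ≗ f ⊛ h ⊕ g ⊛ h
⊛-distribʳ f g h n = trans (Σ-ext (suc n) (λ i → ℤP.*-distribʳ-+ (h (n ∸ i)) (f i) (g i))) (Σ-+ (suc n) _ _)

⊛-distribˡ : ∀ (f g h : ℤSeries) → f ⊛ (g ⊕ h) ≗ f ⊛ g ⊕ f ⊛ h
⊛-distribˡ f g h n = trans (Σ-ext (suc n) (λ i → ℤP.*-distribˡ-+ (f i) (g (n ∸ i)) (h (n ∸ i)))) (Σ-+ (suc n) _ _)

⊛-identityˡ : ∀ (g : ℤSeries) → δ ⊛ g ≗ g
⊛-identityˡ g n = begin
    Σ (suc n) (λ i → δ i * g (n ∸ i))               ≡⟨ Σ-first n (λ i → δ i * g (n ∸ i)) ⟩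
    + 1 * g n + Σ n (λ i → + 0 * g (n ∸ suc i))     ≡⟨ cong₂ _+_ (ℤP.*-identityˡ (g n)) (Σ-zero n (λ _ _ → refl)) ⟩
    g n + + 0                                       ≡⟨ ℤP.+-identityʳ (g n) ⟩
    g n                                             ∎
  where open ≡-Reasoning

⊛-assoc : ∀ (f g h : ℤSeries) → (f ⊛ g) ⊛ h ≗ f ⊛ (g ⊛ h)
⊛-assoc f g h n = begin
    Σ (suc n) (λ m → Σ (suc m) (λ i → f i * g (m ∸ i)) * h (n ∸ m))
  ≡⟨ Σ-ext (suc n) (λ m → sym (Σ-*ʳ (suc m) (h (n ∸ m)) (λ i → f i * g (m ∸ i)))) ⟩
    Σ (suc n) (λ m → Σ (suc m) (λ i → term i m))
  ≡⟨ Σ-triangle (suc n) term ⟩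
    Σ (suc n) (λ i → Σ (suc n ∸ i) (λ t → term i (i +ₙ t)))
  ≡⟨ Σ-cong (suc n) inner ⟩
    Σ (suc n) (λ i → f i * Σ (suc (n ∸ i)) (λ t → g t * h (n ∸ i ∸ t)))
  ∎
  where
  open ≡-Reasoning
  term : ℕ → ℕ → ℤ
  term i m = f i * g (m ∸ i) * h (n ∸ m)
  inner : ∀ i → i < suc n → Σ (suc n ∸ i) (λ t → term i (i +ₙ t)) ≡ f i * Σ (suc (n ∸ i)) (λ t → g t * h (n ∸ i ∸ t))
  inner i (s≤s i≤n) rewrite ℕP.+-∸-assoc 1 i≤n = trans (Σ-ext (suc (n ∸ i)) reindex) (Σ-*ˡ (suc (n ∸ i)) (f i) _)
    where
    reindex : ∀ t → term i (i +ₙ t) ≡ f i * (g t * h (n ∸ i ∸ t))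
    reindex t rewrite ℕP.m+n∸m≡n i t | ℕP.∸-+-assoc n i t = ℤP.*-assoc (f i) (g t) _

⊛-scalar : ∀ (f g : ℤSeries) c → f ⊛ (λ n → c * g n) ≗ (λ n → c * (f ⊛ g) n)
⊛-scalar f g c n = trans (Σ-ext (suc n) (λ i → exchange (f i) c (g (n ∸ i)))) (Σ-*ˡ (suc n) c _)
  where
  exchange : ∀ a b d → a * (b * d) ≡ b * (a * d)
  exchange = solve-∀

⊛-Σ : ∀ (f : ℤSeries) J (G : ℕ → ℤSeries) → f ⊛ (λ n → Σ J (λ j → G j n)) ≗ (λ n → Σ J (λ j → (f ⊛ G j) n))
⊛-Σ f J G n = trans (Σ-ext (suc n) (λ i → sym (Σ-*ˡ J (f i) (λ j → G j (n ∸ i))))) (Σ-swap (suc n) J (λ i j → f i * G j (n ∸ i)))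

⊛-noConstant : ∀ (p f : ℤSeries) → p 0 ≡ + 0 → ∀ n → (p ⊛ f) n ≡ Σ n (λ i → p (suc i) * f (n ∸ suc i))
⊛-noConstant p f p0≡0 n rewrite Σ-first n (λ i → p i * f (n ∸ i)) | p0≡0 = ℤP.+-identityˡ _

base : (ℕ → ℤSeries) → ℕ → ℤSeries
base V zero = δ
base V (suc r) = V r

-- V solves the recursion V r = base V r + p ⊛ V r on all coefficients below N.
-- For p without constant term this says V r = (1 - p)^-(r+1), the (r+1)-st
-- power of the series 1/(1 - p).
PowerFamily : ℤSeries → (ℕ → ℤSeries) → ℕ → Set
PowerFamily p V N = ∀ r n → n < N → V r n ≡ base V r n + (p ⊛ V r) n

powerFamily-unique : ∀ p {V W : ℕ → ℤSeries} {N} → p 0 ≡ + 0 →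
  PowerFamily p V N → PowerFamily p W N → ∀ r n → n < N → V r n ≡ W r n
powerFamily-unique p {V} {W} {N} p0≡0 solV solW r n = <-rec Agree step n r
  where
  Agree : ℕ → Set
  Agree n = ∀ r → n < N → V r n ≡ W r n
  step : ∀ n → (∀ {m} → m < n → Agree m) → Agree n
  step n ih r n<N = begin
      V r n                        ≡⟨ solV r n n<N ⟩
      base V r n + (p ⊛ V r) n     ≡⟨ cong₂ _+_ (sameBase r) sameTail ⟩
      base W r n + (p ⊛ W r) n     ≡⟨ sym (solW r n n<N) ⟩
      W r n                        ∎
    where
    open ≡-Reasoning
    sameBase : ∀ r → base V r n ≡ base W r n
    sameBase zero = refl
    sameBase (suc r) = step n ih r n<N
    earlier : ∀ i → i < n → p (suc i) * V r (n ∸ suc i) ≡ p (suc i) * W r (n ∸ suc i)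
    earlier i i<n = cong (p (suc i) *_)
      (ih (ℕP.∸-monoʳ-< (s≤s z≤n) i<n) r (ℕP.≤-<-trans (ℕP.m∸n≤m n (suc i)) n<N))
    sameTail : (p ⊛ V r) n ≡ (p ⊛ W r) n
    sameTail rewrite ⊛-noConstant p (V r) p0≡0 n | ⊛-noConstant p (W r) p0≡0 n = Σ-cong n earlier

-- The series Σ x^l over the admissible white-tile lengths l ≥ 1.
lengthSeries : (ℕ → Bool) → ℤSeries
lengthSeries admissible zero = + 0
lengthSeries admissible (suc i) = 𝟙 (admissible (suc i))

boundedLength : ℕ → ℕ → Bool
boundedLength k l = (1 ≤ᵇ l) ∧ (l ≤ᵇ k)

fibℤ : ℕ → ℤSeries
fibℤ k n = + F (suc n) k

fibPowℤ : ℕ → ℕ → ℤSeries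
fibPowℤ k r n = + fibSeriesPow k r n

conv-⊛ : ∀ f g n → + conv f g n ≡ ((+_ ∘ f) ⊛ (+_ ∘ g)) n
conv-⊛ f g n = trans (sum-upTo (suc n) (λ i → f i *ₙ g (n ∸ i))) (Σ-ext (suc n) (λ i → ℤP.pos-* (f i) (g (n ∸ i))))

history-suc : ∀ k n → toList (fibHist k (suc n)) ≡ F (suc n) k ∷ toList (fibHist k n)
history-suc k zero = refl
history-suc k (suc n) = refl

sum-take-history : ∀ k k′ n →
  + sum (take k′ (toList (fibHist k n))) ≡ Σ (suc n) (λ i → 𝟙 (i <ᵇ k′) * + F (n ∸ i) k)
sum-take-history k zero n = sym (Σ-zero (suc n) (λ _ _ → refl))
sum-take-history k (suc zero) zero = refl
sum-take-history k (suc (suc k′)) zero = refl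
sum-take-history k (suc k′) (suc n) rewrite history-suc k n = begin
    + (F (suc n) k +ₙ sum (take k′ (toList (fibHist k n))))
  ≡⟨ ℤP.pos-+ (F (suc n) k) _ ⟩
    + F (suc n) k + + sum (take k′ (toList (fibHist k n)))
  ≡⟨ cong₂ _+_ (sym (ℤP.*-identityˡ (+ F (suc n) k))) (sum-take-history k k′ n) ⟩
    𝟙 true * + F (suc n) k + Σ (suc n) (λ i → 𝟙 (suc i <ᵇ suc k′) * + F (suc n ∸ suc i) k)
  ≡⟨ sym (Σ-first (suc n) (λ i → 𝟙 (i <ᵇ suc k′) * + F (suc n ∸ i) k)) ⟩
    Σ (suc (suc n)) (λ i → 𝟙 (i <ᵇ suc k′) * + F (suc n ∸ i) k)
  ∎
  where open ≡-Reasoning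

fib-recursion : ∀ k → fibℤ k ≗ δ ⊕ lengthSeries (boundedLength k) ⊛ fibℤ k
fib-recursion k zero = refl
fib-recursion k (suc m) = begin
    + F (suc (suc m)) k
  ≡⟨ sum-take-history k k (suc m) ⟩
    Σ (suc m) (λ i → 𝟙 (i <ᵇ k) * + F (suc m ∸ i) k) + 𝟙 (suc m <ᵇ k) * + F (m ∸ m) k
  ≡⟨ cong (λ x → Σ (suc m) (λ i → 𝟙 (i <ᵇ k) * + F (suc m ∸ i) k) + 𝟙 (suc m <ᵇ k) * + F x k) (ℕP.n∸n≡0 m) ⟩
    Σ (suc m) (λ i → 𝟙 (i <ᵇ k) * + F (suc m ∸ i) k) + 𝟙 (suc m <ᵇ k) * + 0
  ≡⟨ trans (cong (_+_ (Σ (suc m) _)) (ℤP.*-zeroʳ (𝟙 (suc m <ᵇ k)))) (ℤP.+-identityʳ _) ⟩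
    Σ (suc m) (λ i → 𝟙 (i <ᵇ k) * + F (suc m ∸ i) k)
  ≡⟨ Σ-cong (suc m) (λ i i<sm → cong (λ x → 𝟙 (i <ᵇ k) * + F x k) (ℕP.+-∸-assoc 1 (ℕP.≤-pred i<sm))) ⟩
    Σ (suc m) (λ i → 𝟙 (i <ᵇ k) * fibℤ k (suc m ∸ suc i))
  ≡⟨ sym (⊛-noConstant (lengthSeries (boundedLength k)) (fibℤ k) refl (suc m)) ⟩
    (lengthSeries (boundedLength k) ⊛ fibℤ k) (suc m)
  ≡⟨ sym (ℤP.+-identityˡ _) ⟩
    δ (suc m) + (lengthSeries (boundedLength k) ⊛ fibℤ k) (suc m)
  ∎
  where open ≡-Reasoning

fibPow-family : ∀ k N → PowerFamily (lengthSeries (boundedLength k)) (fibPowℤ k) N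
fibPow-family k N zero n _ = fib-recursion k n
fibPow-family k N (suc r) n _ = begin
    fibPowℤ k (suc r) n
  ≡⟨ conv-⊛ (fibSeries k) (fibSeriesPow k r) n ⟩
    (G ⊛ S) n
  ≡⟨ ⊛-cong {g = S} (fib-recursion k) (λ _ → refl) n ⟩
    ((δ ⊕ p ⊛ G) ⊛ S) n
  ≡⟨ ⊛-distribʳ δ (p ⊛ G) S n ⟩
    (δ ⊛ S) n + (p ⊛ G ⊛ S) n
  ≡⟨ cong₂ _+_ (⊛-identityˡ S n) (⊛-assoc p G S n) ⟩
    S n + (p ⊛ (G ⊛ S)) n
  ≡⟨ cong (_+_ (S n)) (⊛-cong {p} (λ _ → refl) (λ m → sym (conv-⊛ (fibSeries k) (fibSeriesPow k r) m)) n) ⟩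
    S n + (p ⊛ fibPowℤ k (suc r)) n
  ∎
  where
  open ≡-Reasoning
  p : ℤSeries
  p = lengthSeries (boundedLength k)
  G : ℤSeries
  G = fibℤ k
  S : ℤSeries
  S = fibPowℤ k r

allWhites : (ℕ → Bool) → List Piece → Bool
allWhites admissible [] = true
allWhites admissible (red ∷ ps) = allWhites admissible ps
allWhites admissible (white l ∷ ps) = admissible l ∧ allWhites admissible ps

IsTiling : (ℕ → Bool) → ℕ → ℕ → List Piece → Bool
IsTiling admissible r n ps = (numRed ps ≡ᵇ r) ∧ (whiteLength ps ≡ᵇ n) ∧ allWhites admissible ps

count : {X : Set} → (X → Bool) → List X → ℤ
count p xs = ΣL xs (𝟙 ∘ p)

≡ᵇ-+ : ∀ l x n → (l +ₙ x ≡ᵇ n) ≡ (l ≤ᵇ n) ∧ (x ≡ᵇ n ∸ l)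
≡ᵇ-+ zero x n = refl
≡ᵇ-+ (suc l) x zero = refl
≡ᵇ-+ (suc l) x (suc n) = trans (≡ᵇ-+ l x n) (cong (_∧ (x ≡ᵇ n ∸ l)) (sym (≤ᵇ-suc l n)))

isTiling-white : ∀ admissible r n l w →
  𝟙 (IsTiling admissible r n (white l ∷ w)) ≡ 𝟙 (l ≤ᵇ n) * 𝟙 (admissible l) * 𝟙 (IsTiling admissible r (n ∸ l) w)
isTiling-white admissible r n l w = begin
    𝟙 (R ∧ (l +ₙ whiteLength w ≡ᵇ n) ∧ (A ∧ W))
  ≡⟨ cong (λ b → 𝟙 (R ∧ b ∧ (A ∧ W))) (≡ᵇ-+ l (whiteLength w) n) ⟩
    𝟙 (R ∧ ((l ≤ᵇ n) ∧ X) ∧ (A ∧ W))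
  ≡⟨ expand ⟩
    𝟙 R * ((𝟙 (l ≤ᵇ n) * 𝟙 X) * (𝟙 A * 𝟙 W))
  ≡⟨ regroup (𝟙 R) (𝟙 (l ≤ᵇ n)) (𝟙 X) (𝟙 A) (𝟙 W) ⟩
    𝟙 (l ≤ᵇ n) * 𝟙 A * (𝟙 R * (𝟙 X * 𝟙 W))
  ≡⟨ cong (𝟙 (l ≤ᵇ n) * 𝟙 A *_) (sym collapse) ⟩
    𝟙 (l ≤ᵇ n) * 𝟙 A * 𝟙 (R ∧ X ∧ W)
  ∎
  where
  open ≡-Reasoning
  R X A W : Bool
  R = numRed w ≡ᵇ r
  X = whiteLength w ≡ᵇ n ∸ l
  A = admissible l
  W = allWhites admissible w
  expand : 𝟙 (R ∧ ((l ≤ᵇ n) ∧ X) ∧ (A ∧ W)) ≡ 𝟙 R * ((𝟙 (l ≤ᵇ n) * 𝟙 X) * (𝟙 A * 𝟙 W))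
  expand rewrite 𝟙-∧ R (((l ≤ᵇ n) ∧ X) ∧ (A ∧ W)) | 𝟙-∧ ((l ≤ᵇ n) ∧ X) (A ∧ W)
               | 𝟙-∧ (l ≤ᵇ n) X | 𝟙-∧ A W = refl
  collapse : 𝟙 (R ∧ X ∧ W) ≡ 𝟙 R * (𝟙 X * 𝟙 W)
  collapse rewrite 𝟙-∧ R (X ∧ W) | 𝟙-∧ X W = refl
  regroup : ∀ a b c d e → a * ((b * c) * (d * e)) ≡ b * d * (a * (c * e))
  regroup = solve-∀

withoutRed : (ℕ → ℤ) → ℕ → ℤ
withoutRed c zero = + 0
withoutRed c (suc r) = c r

module Counting (admissible : ℕ → Bool) (N : ℕ) where

  alphabet : List Piece
  alphabet = pieceAlphabet N

  exactly : ℕ → ℕ → ℕ → ℤ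
  exactly m r n = count (IsTiling admissible r n) (words alphabet m)

  atMost : ℕ → ℕ → ℕ → ℤ
  atMost M r n = count (IsTiling admissible r n) (wordsUpTo alphabet M)

  weight : ℕ → ℕ → ℤ
  weight n i = 𝟙 (suc i ≤ᵇ n) * 𝟙 (admissible (suc i))

  ΣL-alphabet : ∀ (f : Piece → ℤ) → ΣL alphabet f ≡ f red + Σ N (λ i → f (white (suc i)))
  ΣL-alphabet f = cong (_+_ (f red)) (trans (ΣL-map (λ i → white (suc i)) (upTo N) f) (ΣL-upTo N _))

  -- Classifying tilings with m + 1 pieces by their first piece.
  exactly-suc : ∀ m r n → exactly (suc m) r n ≡
    withoutRed (λ r → exactly m r n) r + Σ N (λ i → weight n i * exactly m r (n ∸ suc i))
  exactly-suc m r n = begin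
      count P (concatMap (λ w → map (_∷ w) alphabet) ws)
    ≡⟨ ΣL-concatMap (λ w → map (_∷ w) alphabet) ws (𝟙 ∘ P) ⟩
      ΣL ws (λ w → ΣL (map (_∷ w) alphabet) (𝟙 ∘ P))
    ≡⟨ ΣL-ext ws (λ w → ΣL-map (_∷ w) alphabet (𝟙 ∘ P)) ⟩
      ΣL ws (λ w → ΣL alphabet (λ a → 𝟙 (P (a ∷ w))))
    ≡⟨ ΣL-swap ws alphabet (λ w a → 𝟙 (P (a ∷ w))) ⟩
      ΣL alphabet (λ a → ΣL ws (λ w → 𝟙 (P (a ∷ w))))
    ≡⟨ ΣL-alphabet (λ a → ΣL ws (λ w → 𝟙 (P (a ∷ w)))) ⟩
      ΣL ws (λ w → 𝟙 (P (red ∷ w))) + Σ N (λ i → ΣL ws (λ w → 𝟙 (P (white (suc i) ∷ w))))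
    ≡⟨ cong₂ _+_ (firstRed r) (Σ-ext N firstWhite) ⟩
      withoutRed (λ r → exactly m r n) r + Σ N (λ i → weight n i * exactly m r (n ∸ suc i))
    ∎
    where
    open ≡-Reasoning
    ws : List (List Piece)
    ws = words alphabet m
    P : List Piece → Bool
    P = IsTiling admissible r n
    firstRed : ∀ r → ΣL ws (λ w → 𝟙 (IsTiling admissible r n (red ∷ w))) ≡ withoutRed (λ r → exactly m r n) r
    firstRed zero = ΣL-zero ws
    firstRed (suc r) = refl
    firstWhite : ∀ i → ΣL ws (λ w → 𝟙 (P (white (suc i) ∷ w))) ≡ weight n i * exactly m r (n ∸ suc i)
    firstWhite i = trans (ΣL-ext ws (isTiling-white admissible r n (suc i))) (ΣL-*ˡ ws (weight n i) (𝟙 ∘ IsTiling admissible r (n ∸ suc i)))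

  atMost-Σ : ∀ M r n → atMost M r n ≡ Σ (suc M) (λ m → exactly m r n)
  atMost-Σ M r n = trans (ΣL-concatMap (words alphabet) (upTo (suc M)) (𝟙 ∘ IsTiling admissible r n)) (ΣL-upTo (suc M) (λ m → exactly m r n))

  atMost-suc : ∀ M r n → atMost (suc M) r n ≡
    exactly 0 r n + (withoutRed (λ r → atMost M r n) r + Σ N (λ i → weight n i * atMost M r (n ∸ suc i)))
  atMost-suc M r n = begin
      atMost (suc M) r n
    ≡⟨ trans (atMost-Σ (suc M) r n) (Σ-first (suc M) (λ m → exactly m r n)) ⟩
      exactly 0 r n + Σ (suc M) (λ m → exactly (suc m) r n)
    ≡⟨ cong (_+_ (exactly 0 r n)) (trans (Σ-ext (suc M) (λ m → exactly-suc m r n)) (Σ-+ (suc M) _ _)) ⟩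
      exactly 0 r n + (Σ (suc M) (λ m → withoutRed (λ r → exactly m r n) r)
                       + Σ (suc M) (λ m → Σ N (λ i → weight n i * exactly m r (n ∸ suc i))))
    ≡⟨ cong (_+_ (exactly 0 r n)) (cong₂ _+_ (firstRed r) firstWhite) ⟩
      exactly 0 r n + (withoutRed (λ r → atMost M r n) r + Σ N (λ i → weight n i * atMost M r (n ∸ suc i)))
    ∎
    where
    open ≡-Reasoning
    firstRed : ∀ r → Σ (suc M) (λ m → withoutRed (λ r → exactly m r n) r) ≡ withoutRed (λ r → atMost M r n) r
    firstRed zero = Σ-zero (suc M) (λ _ _ → refl)
    firstRed (suc r) = sym (atMost-Σ M r n)
    firstWhite : Σ (suc M) (λ m → Σ N (λ i → weight n i * exactly m r (n ∸ suc i))) ≡ Σ N (λ i → weight n i * atMost M r (n ∸ suc i))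
    firstWhite = trans (Σ-swap (suc M) N (λ m i → weight n i * exactly m r (n ∸ suc i)))
      (Σ-ext N (λ i → trans (Σ-*ˡ (suc M) (weight n i) (λ m → exactly m r (n ∸ suc i))) (cong (weight n i *_) (sym (atMost-Σ M r (n ∸ suc i))))))

  -- Every solution of the tiling recursion counts tilings: with at most M ≥ n + r
  -- pieces and tiles of length at most N ≥ n, all tilings are enumerated.
  module _ (V : ℕ → ℤSeries) (solV : PowerFamily (lengthSeries admissible) V (suc N)) where

    countsTilings : ∀ M r n → n +ₙ r ≤ M → n ≤ N → atMost M r n ≡ V r n
    countsTilings zero zero zero _ _ = sym (solV zero zero (s≤s z≤n))
    countsTilings zero zero (suc n) () _
    countsTilings zero (suc r) zero () _
    countsTilings zero (suc r) (suc n) () _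
    countsTilings (suc M) r n n+r≤1+M n≤N = begin
        atMost (suc M) r n
      ≡⟨ atMost-suc M r n ⟩
        exactly 0 r n + (withoutRed (λ r → atMost M r n) r + Σ N (λ i → weight n i * atMost M r (n ∸ suc i)))
      ≡⟨ firstPiece r n+r≤1+M ⟩
        base V r n + (lengthSeries admissible ⊛ V r) n
      ≡⟨ sym (solV r n (s≤s n≤N)) ⟩
        V r n
      ∎
      where
      open ≡-Reasoning
      p : ℤSeries
      p = lengthSeries admissible
      firstWhite : ∀ r → n +ₙ r ≤ suc M → Σ N (λ i → weight n i * atMost M r (n ∸ suc i)) ≡ (p ⊛ V r) n
      firstWhite r n+r≤1+M = begin
          Σ N (λ i → weight n i * atMost M r (n ∸ suc i))
        ≡⟨ Σ-ext N (λ i → ℤP.*-assoc (𝟙 (suc i ≤ᵇ n)) _ _) ⟩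
          Σ N (λ i → 𝟙 (suc i ≤ᵇ n) * (p (suc i) * atMost M r (n ∸ suc i)))
        ≡⟨ Σ-truncate N n (λ i → p (suc i) * atMost M r (n ∸ suc i)) n≤N ⟩
          Σ n (λ i → p (suc i) * atMost M r (n ∸ suc i))
        ≡⟨ Σ-cong n (λ i i<n → cong (p (suc i) *_) (countsTilings M r (n ∸ suc i) (shorter i i<n) (ℕP.≤-trans (ℕP.m∸n≤m n (suc i)) n≤N))) ⟩
          Σ n (λ i → p (suc i) * V r (n ∸ suc i))
        ≡⟨ sym (⊛-noConstant p (V r) refl n) ⟩
          (p ⊛ V r) n
        ∎
        where
        shorter : ∀ i → i < n → n ∸ suc i +ₙ r ≤ M
        shorter i i<n = ℕP.≤-pred (ℕP.<-≤-trans (ℕP.+-monoˡ-< r (ℕP.∸-monoʳ-< (s≤s z≤n) i<n)) n+r≤1+M)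
      emptyTiling : ∀ n → exactly 0 zero n ≡ δ n
      emptyTiling zero = refl
      emptyTiling (suc n) = refl
      firstPiece : ∀ r → n +ₙ r ≤ suc M →
        exactly 0 r n + (withoutRed (λ r → atMost M r n) r + Σ N (λ i → weight n i * atMost M r (n ∸ suc i)))
          ≡ base V r n + (p ⊛ V r) n
      firstPiece zero le = cong₂ _+_ (emptyTiling n) (trans (ℤP.+-identityˡ _) (firstWhite zero le))
      firstPiece (suc r) le = trans (ℤP.+-identityˡ _)
        (cong₂ _+_ (countsTilings M r n (ℕP.≤-pred (subst (_≤ suc M) (ℕP.+-suc n r) le)) n≤N) (firstWhite (suc r) le))

count-tilings : ∀ (whitesOK : List Piece → Bool) admissible → (∀ ps → whitesOK ps ≡ allWhites admissible ps) →
  ∀ r n (xs : List (List Piece)) →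
  + length (filterᵇ (λ ps → (numRed ps ≡ᵇ r) ∧ (whiteLength ps ≡ᵇ n) ∧ whitesOK ps) xs)
    ≡ count (IsTiling admissible r n) xs
count-tilings whitesOK admissible same r n xs =
  trans (length-filter _ xs) (ΣL-ext xs (λ ps → cong (λ b → 𝟙 ((numRed ps ≡ᵇ r) ∧ (whiteLength ps ≡ᵇ n) ∧ b)) (same ps)))

whitesBounded-allWhites : ∀ k ps → whitesBounded k ps ≡ allWhites (boundedLength k) ps
whitesBounded-allWhites k [] = refl
whitesBounded-allWhites k (red ∷ ps) = whitesBounded-allWhites k ps
whitesBounded-allWhites k (white l ∷ ps) =
  trans (cong (λ b → (1 ≤ᵇ l) ∧ (l ≤ᵇ k) ∧ b) (whitesBounded-allWhites k ps)) (sym (∧-assoc (1 ≤ᵇ l) (l ≤ᵇ k) _))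

whitesPositive-allWhites : ∀ ps → whitesPositive ps ≡ allWhites (1 ≤ᵇ_) ps
whitesPositive-allWhites [] = refl
whitesPositive-allWhites (red ∷ ps) = whitesPositive-allWhites ps
whitesPositive-allWhites (white l ∷ ps) = cong ((1 ≤ᵇ l) ∧_) (whitesPositive-allWhites ps)

aTile-fibPow : ∀ r n k → + aTile r n k ≡ fibPowℤ k r n
aTile-fibPow r n k =
  trans (count-tilings (whitesBounded k) (boundedLength k) (whitesBounded-allWhites k) r n (wordsUpTo (pieceAlphabet n) (n +ₙ r)))
        (Counting.countsTilings (boundedLength k) n (fibPowℤ k) (fibPow-family k (suc n)) (n +ₙ r) r n ℕP.≤-refl ℕP.≤-refl)

-- free r solves the tiling recursion for white tiles of arbitrary positive length,
-- free r = base free r + x/(1-x) · free r; it is computed together with its partial sums.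
mutual
  free : ℕ → ℤSeries
  free zero n = δ n + partialFree zero n
  free (suc r) n = free r n + partialFree (suc r) n

  partialFree : ℕ → ℤSeries
  partialFree r zero = + 0
  partialFree r (suc n) = partialFree r n + free r n

partialFree-Σ : ∀ r n → partialFree r n ≡ Σ n (free r)
partialFree-Σ r zero = refl
partialFree-Σ r (suc n) = cong (_+ free r n) (partialFree-Σ r n)

positive-⊛ : ∀ (f : ℤSeries) n → (lengthSeries (1 ≤ᵇ_) ⊛ f) n ≡ Σ n f
positive-⊛ f n = begin
    (lengthSeries (1 ≤ᵇ_) ⊛ f) n           ≡⟨ ⊛-noConstant (lengthSeries (1 ≤ᵇ_)) f refl n ⟩
    Σ n (λ i → + 1 * f (n ∸ suc i))        ≡⟨ Σ-ext n (λ i → ℤP.*-identityˡ (f (n ∸ suc i))) ⟩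
    Σ n (λ i → f (n ∸ suc i))              ≡⟨ Σ-reverse n f ⟩
    Σ n f                                  ∎
  where open ≡-Reasoning

free-recursion : ∀ r → free r ≗ base free r ⊕ lengthSeries (1 ≤ᵇ_) ⊛ free r
free-recursion zero n = cong (_+_ (δ n)) (trans (partialFree-Σ zero n) (sym (positive-⊛ (free zero) n)))
free-recursion (suc r) n = cong (_+_ (free r n)) (trans (partialFree-Σ (suc r) n) (sym (positive-⊛ (free (suc r)) n)))

aFree-free : ∀ r n → + aFree r n ≡ free r n
aFree-free r n =
  trans (count-tilings whitesPositive (1 ≤ᵇ_) whitesPositive-allWhites r n (wordsUpTo (pieceAlphabet n) (n +ₙ r)))
        (Counting.countsTilings (1 ≤ᵇ_) n free (λ r n _ → free-recursion r n) (n +ₙ r) r n ℕP.≤-refl ℕP.≤-refl)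

_^[_]⊛_ : ℤSeries → ℕ → ℤSeries → ℤSeries
c ^[ zero ]⊛ f = f
c ^[ suc j ]⊛ f = c ⊛ (c ^[ j ]⊛ f)

-- If f = b + (p + c) f, then c^j f = p c^j f + (c^j b + c^(j+1) f): the basic
-- step that lets an alternating sum of the c^j f telescope.
peel : ∀ p c b f → f ≗ b ⊕ (p ⊕ c) ⊛ f → ∀ j → c ^[ j ]⊛ f ≗ p ⊛ (c ^[ j ]⊛ f) ⊕ (c ^[ j ]⊛ b ⊕ c ^[ suc j ]⊛ f)
peel p c b f eq zero n = begin
    f n                                      ≡⟨ eq n ⟩
    b n + ((p ⊕ c) ⊛ f) n                    ≡⟨ cong (_+_ (b n)) (⊛-distribʳ p c f n) ⟩
    b n + ((p ⊛ f) n + (c ⊛ f) n)            ≡⟨ exchange (b n) ((p ⊛ f) n) ((c ⊛ f) n) ⟩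
    (p ⊛ f) n + (b n + (c ⊛ f) n)            ∎
  where
  open ≡-Reasoning
  exchange : ∀ x y z → x + (y + z) ≡ y + (x + z)
  exchange = solve-∀
peel p c b f eq (suc j) n = begin
    (c ⊛ cf) n
  ≡⟨ ⊛-cong {c} (λ _ → refl) (peel p c b f eq j) n ⟩
    (c ⊛ (p ⊛ cf ⊕ (cb ⊕ c ⊛ cf))) n
  ≡⟨ ⊛-distribˡ c (p ⊛ cf) (cb ⊕ c ⊛ cf) n ⟩
    (c ⊛ (p ⊛ cf)) n + (c ⊛ (cb ⊕ c ⊛ cf)) n
  ≡⟨ cong₂ _+_ commute (⊛-distribˡ c cb (c ⊛ cf) n) ⟩
    (p ⊛ (c ⊛ cf)) n + ((c ⊛ cb) n + (c ⊛ (c ⊛ cf)) n)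
  ∎
  where
  open ≡-Reasoning
  cf : ℤSeries
  cf = c ^[ j ]⊛ f
  cb : ℤSeries
  cb = c ^[ j ]⊛ b
  commute : (c ⊛ (p ⊛ cf)) n ≡ (p ⊛ (c ⊛ cf)) n
  commute = trans (sym (⊛-assoc c p cf n)) (trans (⊛-cong {g = cf} (⊛-comm c p) (λ _ → refl) n) (⊛-assoc p c cf n))

^⊛-vanish : ∀ c f → c 0 ≡ + 0 → ∀ j n → n < j → (c ^[ j ]⊛ f) n ≡ + 0
^⊛-vanish c f c0≡0 (suc j) n (s≤s n≤j) = begin
    (c ⊛ (c ^[ j ]⊛ f)) n
  ≡⟨ ⊛-noConstant c (c ^[ j ]⊛ f) c0≡0 n ⟩
    Σ n (λ i → c (suc i) * (c ^[ j ]⊛ f) (n ∸ suc i))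
  ≡⟨ Σ-zero n (λ i i<n → trans (cong (c (suc i) *_) (^⊛-vanish c f c0≡0 j (n ∸ suc i) (below i i<n))) (ℤP.*-zeroʳ (c (suc i)))) ⟩
    + 0
  ∎
  where
  open ≡-Reasoning
  below : ∀ i → i < n → n ∸ suc i < j
  below i i<n = ℕP.<-≤-trans (ℕP.∸-monoʳ-< (s≤s z≤n) i<n) n≤j

aIterSub-indicator : ∀ s m n d → + aIterSub s m n d ≡ 𝟙 (d ≤ᵇ n) * + aIter s m (n ∸ d)
aIterSub-indicator s m n d with d ≤ᵇ n
... | true = sym (ℤP.*-identityˡ (+ aIter s m (n ∸ d)))
... | false = refl

aIterSub-partialSum : ∀ s m n e → + aIterSub (suc s) m n (suc e) ≡ Σ (n ∸ e) (+_ ∘ aIter s m)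
aIterSub-partialSum s m n e with suc e ≤? n
... | yes e<n rewrite ≤ᵇ-true e<n =
  trans (sum-upTo (suc (n ∸ suc e)) (aIter s m)) (cong (λ x → Σ x (+_ ∘ aIter s m)) (terms e<n))
  where
  terms : ∀ {n} → suc e ≤ n → suc (n ∸ suc e) ≡ n ∸ e
  terms (s≤s e≤n) = sym (ℕP.+-∸-assoc 1 e≤n)
... | no e≮n rewrite ≤ᵇ-false e≮n =
  cong (λ x → Σ x (+_ ∘ aIter s m)) (sym (ℕP.m≤n⇒m∸n≡0 (ℕP.≤-pred (ℕP.≰⇒> e≮n))))

sumℤ-map : ∀ {X : Set} (h : X → ℤ) xs → sumℤ (map h xs) ≡ ΣL xs h
sumℤ-map h [] = refl
sumℤ-map h (x ∷ xs) = cong (_+_ (h x)) (sumℤ-map h xs)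

module AlternatingSum (k : ℕ) where

  p : ℤSeries
  p = lengthSeries (boundedLength k)

  -- x^(k+1)/(1 - x), the series of white tiles longer than k.
  longTiles : ℤSeries
  longTiles t = 𝟙 (suc k ≤ᵇ t)

  positive-split : lengthSeries (1 ≤ᵇ_) ≗ p ⊕ longTiles
  positive-split zero = refl
  positive-split (suc i) = sym (split i k)
    where
    split : ∀ i k → 𝟙 (i <ᵇ k) + 𝟙 (k <ᵇ suc i) ≡ + 1
    split zero zero = refl
    split zero (suc k) = refl
    split (suc i) zero = refl
    split (suc i) (suc k) = split i k

  longTiles-⊛ : ∀ f n → (longTiles ⊛ f) n ≡ Σ (n ∸ k) f
  longTiles-⊛ f n = begin
      (longTiles ⊛ f) n                                ≡⟨ ⊛-comm longTiles f n ⟩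
      Σ (suc n) (λ i → f i * 𝟙 (suc k ≤ᵇ n ∸ i))        ≡⟨ Σ-ext (suc n) reorder ⟩
      Σ (suc n) (λ i → 𝟙 (suc i ≤ᵇ n ∸ k) * f i)        ≡⟨ Σ-truncate (suc n) (n ∸ k) f (ℕP.≤-trans (ℕP.m∸n≤m n k) (ℕP.n≤1+n n)) ⟩
      Σ (n ∸ k) f                                      ∎
    where
    open ≡-Reasoning
    sameTest : ∀ i → (suc k ≤ᵇ n ∸ i) ≡ (suc i ≤ᵇ n ∸ k)
    sameTest i = trans (≤ᵇ-∸ k i n) (trans (cong (λ x → suc x ≤ᵇ n) (ℕP.+-comm k i)) (sym (≤ᵇ-∸ i k n)))
    reorder : ∀ i → f i * 𝟙 (suc k ≤ᵇ n ∸ i) ≡ 𝟙 (suc i ≤ᵇ n ∸ k) * f i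
    reorder i rewrite sameTest i = ℤP.*-comm (f i) _

  -- E m j is the generating series of n ↦ a_j(m, n - j(k+1)).
  E : ℕ → ℕ → ℤSeries
  E m j = longTiles ^[ j ]⊛ free m

  aIterSub-E : ∀ j m n → + aIterSub j m n (j *ₙ suc k) ≡ E m j n
  aIterSub-E zero m n = aFree-free m n
  aIterSub-E (suc j) m n = begin
      + aIterSub (suc j) m n (suc k +ₙ d)
    ≡⟨ aIterSub-partialSum j m n (k +ₙ d) ⟩
      Σ (n ∸ (k +ₙ d)) (+_ ∘ aIter j m)
    ≡⟨ cong (λ x → Σ x (+_ ∘ aIter j m)) (sym (ℕP.∸-+-assoc n k d)) ⟩
      Σ (n ∸ k ∸ d) (+_ ∘ aIter j m)
    ≡⟨ sym (Σ-shift (n ∸ k) d (+_ ∘ aIter j m)) ⟩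
      Σ (n ∸ k) (λ i → 𝟙 (d ≤ᵇ i) * + aIter j m (i ∸ d))
    ≡⟨ Σ-ext (n ∸ k) (λ i → trans (sym (aIterSub-indicator j m i d)) (aIterSub-E j m i)) ⟩
      Σ (n ∸ k) (E m j)
    ≡⟨ sym (longTiles-⊛ (E m j) n) ⟩
      E m (suc j) n
    ∎
    where
    open ≡-Reasoning
    d : ℕ
    d = j *ₙ suc k

  E-step : ∀ m j → E m j ≗ p ⊛ E m j ⊕ (longTiles ^[ j ]⊛ base free m ⊕ E m (suc j))
  E-step m = peel p longTiles (base free m) (free m) free-split
    where
    free-split : free m ≗ base free m ⊕ (p ⊕ longTiles) ⊛ free m
    free-split n = trans (free-recursion m n) (cong (_+_ (base free m n)) (⊛-cong {g = free m} positive-split (λ _ → refl) n))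

  E-vanish : ∀ m j n → n < j → E m j n ≡ + 0
  E-vanish m = ^⊛-vanish longTiles (free m) refl

  coef : ℕ → ℕ → ℤ
  coef r j = (-1ℤ ^ j) * + ((r +ₙ j) C r)

  altSeries : ℕ → ℕ → ℤSeries
  altSeries N r n = Σ N (λ j → coef r j * E (r +ₙ j) j n)

  altSum-altSeries : ∀ r n → altSum r n k ≡ altSeries (suc n) r n
  altSum-altSeries r n =
    trans (sumℤ-map term (upTo (suc n)))
      (trans (ΣL-upTo (suc n) term) (Σ-ext (suc n) (λ j → cong (coef r j *_) (aIterSub-E j (r +ₙ j) n))))
    where
    term : ℕ → ℤ
    term j = coef r j * + aIterSub j (r +ₙ j) n (j *ₙ suc k)

  leftover : ℕ → ℕ → ℕ → ℤ
  leftover r j n = (longTiles ^[ j ]⊛ base free (r +ₙ j)) n + E (r +ₙ j) (suc j) n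

  -- For r = 0 the leftovers telescope to 1.
  leftover-zero : ∀ N n → n < N → Σ N (λ j → coef 0 j * leftover 0 j n) ≡ δ n
  leftover-zero zero n ()
  leftover-zero N@(suc N′) n n<N = begin
      Σ N (λ j → coef 0 j * leftover 0 j n)   ≡⟨ Σ-ext N difference ⟩
      Σ N (λ j → d j - d (suc j))             ≡⟨ Σ-telescope N d ⟩
      δ n - d N                               ≡⟨ cong (δ n -_) lastVanishes ⟩
      δ n - + 0                               ≡⟨ ℤP.+-identityʳ (δ n) ⟩
      δ n                                     ∎
    where
    open ≡-Reasoning
    d : ℕ → ℤ
    d zero = δ n
    d (suc j) = (-1ℤ ^ suc j) * E j (suc j) n
    difference : ∀ j → coef 0 j * leftover 0 j n ≡ d j - d (suc j)
    difference zero = identity (δ n) (E 0 1 n)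
      where
      identity : ∀ a b → + 1 * + 1 * (a + b) ≡ a - (-1ℤ * + 1) * b
      identity = solve-∀
    difference (suc j) = identity (-1ℤ ^ j) (E j (suc j) n) (E (suc j) (suc (suc j)) n)
      where
      identity : ∀ s a b → (-1ℤ * s) * + 1 * (a + b) ≡ (-1ℤ * s) * a - (-1ℤ * (-1ℤ * s)) * b
      identity = solve-∀
    lastVanishes : d N ≡ + 0
    lastVanishes rewrite E-vanish N′ N n n<N = ℤP.*-zeroʳ (-1ℤ ^ N)

  -- For r + 1 the leftovers telescope, by Pascal's rule, to the alternating sum for r.
  leftover-suc : ∀ N r n → n < N → Σ N (λ j → coef (suc r) j * leftover (suc r) j n) ≡ altSeries N r n
  leftover-suc zero r n ()
  leftover-suc N@(suc N′) r n n<N = begin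
      Σ N (λ j → coef (suc r) j * leftover (suc r) j n)
    ≡⟨ Σ-ext N pascal ⟩
      Σ N (λ j → coef r j * E (r +ₙ j) j n + (b j - b (suc j)))
    ≡⟨ Σ-+ N (λ j → coef r j * E (r +ₙ j) j n) (λ j → b j - b (suc j)) ⟩
      altSeries N r n + Σ N (λ j → b j - b (suc j))
    ≡⟨ cong (_+_ (altSeries N r n)) (Σ-telescope N b) ⟩
      altSeries N r n + (b 0 - b N)
    ≡⟨ cong (λ x → altSeries N r n + (x - b N)) firstVanishes ⟩
      altSeries N r n + (+ 0 - b N)
    ≡⟨ cong (λ x → altSeries N r n + (+ 0 - x)) lastVanishes ⟩
      altSeries N r n + + 0
    ≡⟨ ℤP.+-identityʳ _ ⟩
      altSeries N r n
    ∎
    where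
    open ≡-Reasoning
    b : ℕ → ℤ
    b j = (-1ℤ ^ j) * + ((r +ₙ j) C suc r) * E (r +ₙ j) j n
    firstVanishes : b 0 ≡ + 0
    firstVanishes rewrite ℕP.+-identityʳ r | k>n⇒nCk≡0 (ℕP.n<1+n r) = ℤP.*-zeroˡ (E r 0 n)
    lastVanishes : b N ≡ + 0
    lastVanishes rewrite E-vanish (r +ₙ N) N n n<N = ℤP.*-zeroʳ ((-1ℤ ^ N) * + ((r +ₙ N) C suc r))
    pascal : ∀ j → coef (suc r) j * leftover (suc r) j n ≡ coef r j * E (r +ₙ j) j n + (b j - b (suc j))
    pascal j rewrite ℕP.+-suc r j | sym (nCk+nC[k+1]≡[n+1]C[k+1] (r +ₙ j) r) | ℤP.pos-+ ((r +ₙ j) C r) ((r +ₙ j) C suc r) =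
      identity (-1ℤ ^ j) (+ ((r +ₙ j) C r)) (+ ((r +ₙ j) C suc r)) (E (r +ₙ j) j n) (E (suc (r +ₙ j)) (suc j) n)
      where
      identity : ∀ s A B e₁ e₂ → s * (A + B) * (e₁ + e₂) ≡ s * A * e₁ + (s * B * e₁ - (-1ℤ * s) * (A + B) * e₂)
      identity = solve-∀

  leftover-sum : ∀ N r n → n < N → Σ N (λ j → coef r j * leftover r j n) ≡ base (altSeries N) r n
  leftover-sum N zero n = leftover-zero N n
  leftover-sum N (suc r) n = leftover-suc N r n

  p-⊛-altSeries : ∀ N r n → (p ⊛ altSeries N r) n ≡ Σ N (λ j → coef r j * (p ⊛ E (r +ₙ j) j) n)
  p-⊛-altSeries N r n = trans (⊛-Σ p N (λ j n → coef r j * E (r +ₙ j) j n) n)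
                              (Σ-ext N (λ j → ⊛-scalar p (E (r +ₙ j) j) (coef r j) n))

  altSeries-family : ∀ N → PowerFamily p (altSeries N) N
  altSeries-family N r n n<N = begin
      altSeries N r n
    ≡⟨ Σ-ext N (λ j → trans (cong (coef r j *_) (E-step (r +ₙ j) j n)) (ℤP.*-distribˡ-+ (coef r j) _ _)) ⟩
      Σ N (λ j → coef r j * (p ⊛ E (r +ₙ j) j) n + coef r j * leftover r j n)
    ≡⟨ Σ-+ N _ _ ⟩
      Σ N (λ j → coef r j * (p ⊛ E (r +ₙ j) j) n) + Σ N (λ j → coef r j * leftover r j n)
    ≡⟨ cong₂ _+_ (sym (p-⊛-altSeries N r n)) (leftover-sum N r n n<N) ⟩
      (p ⊛ altSeries N r) n + base (altSeries N) r n
    ≡⟨ ℤP.+-comm ((p ⊛ altSeries N r) n) (base (altSeries N) r n) ⟩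
      base (altSeries N) r n + (p ⊛ altSeries N r) n
    ∎
    where open ≡-Reasoning

mainTheorem6 : (n k r : ℕ) →
    (Fconv (suc n) k r ≡ aTile r n k) × (+ aTile r n k ≡ altSum r n k)
mainTheorem6 n k r = ℤP.+-injective (sym (aTile-fibPow r n k)) , alternating
  where
  open AlternatingSum k
  open ≡-Reasoning
  alternating : + aTile r n k ≡ altSum r n k
  alternating = begin
      + aTile r n k            ≡⟨ aTile-fibPow r n k ⟩
      fibPowℤ k r n            ≡⟨ powerFamily-unique p refl (fibPow-family k (suc n)) (altSeries-family (suc n)) r n ℕP.≤-refl ⟩
      altSeries (suc n) r n    ≡⟨ sym (altSum-altSeries r n) ⟩
      altSum r n k             ∎
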